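{- Let $R$ be a commutative ring with identity whose Jacobson radical $J(R)$ is $0$. Then $\operatorname{diam}(\Gamma_0(R))\le 2$; that is, any two distinct vertices of $\Gamma_0(R)$ are at distance at most $2$.
   Context: All rings are commutative with identity. $\Gamma_0(R)$ is the simple graph whose vertices are the non-trivial ideals of $R$ (ideals other than $0$ and $R$), two distinct ideals $I,J$ being adjacent iff $IJ=I\cap J$. $J(R)$ is the intersection of all maximal ideals of $R$. -}

module Defs where

open import Level using (Level; _⊔_; suc)
open import Algebra.Bundles using (CommutativeRing)
open import Data.Product using (Σ; Σ-syntax; _×_; _,_)
open import Data.Sum using (_⊎_)
open import Data.List using (List; []; _∷_)
open import Data.List.Relation.Unary.All using (All)
open import Relation.Nullary using (¬_)

module _ {c ℓ : Level} (R : CommutativeRing c ℓ) where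
  open CommutativeRing R

  record Ideal : Set (suc (c ⊔ ℓ)) where
    field
      mem     : Carrier → Set (c ⊔ ℓ)
      mem-resp : ∀ {x y} → x ≈ y → mem x → mem y
      mem-0#   : mem 0#
      mem-+    : ∀ {x y} → mem x → mem y → mem (x + y)
      mem-*    : ∀ r {x} → mem x → mem (r * x)

  open Ideal public

  _∈_ : Carrier → Ideal → Set (c ⊔ ℓ)
  x ∈ I = mem I x
  infix 4 _∈_

  _⊆_ : Ideal → Ideal → Set (c ⊔ ℓ)
  I ⊆ J = ∀ x → x ∈ I → x ∈ J

  _≐_ : Ideal → Ideal → Set (c ⊔ ℓ)
  I ≐ J = I ⊆ J × J ⊆ I

  sumProd : List (Carrier × Carrier) → Carrier
  sumProd [] = 0#
  sumProd ((a , b) ∷ ps) = a * b + sumProd ps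

  -- membership in the product ideal IJ (generated by all products ab,
  -- a ∈ I, b ∈ J), i.e. finite sums of such products
  _∈Prod[_,_] : Carrier → Ideal → Ideal → Set (c ⊔ ℓ)
  x ∈Prod[ I , J ] =
    Σ[ ps ∈ List (Carrier × Carrier) ]
      (All (λ p → (Data.Product.proj₁ p ∈ I) × (Data.Product.proj₂ p ∈ J)) ps
       × x ≈ sumProd ps)

  _∈Inter[_,_] : Carrier → Ideal → Ideal → Set (c ⊔ ℓ)
  x ∈Inter[ I , J ] = (x ∈ I) × (x ∈ J)

  ProdEqInter : Ideal → Ideal → Set (c ⊔ ℓ)
  ProdEqInter I J =
    ∀ x → (x ∈Prod[ I , J ] → x ∈Inter[ I , J ])
        × (x ∈Inter[ I , J ] → x ∈Prod[ I , J ])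

  NonTrivial : Ideal → Set (c ⊔ ℓ)
  NonTrivial I = (¬ (∀ x → x ∈ I → x ≈ 0#)) × (¬ (1# ∈ I))

  -- adjacency in Γ₀(R): distinct vertices with IJ = I ∩ J
  Adjacent : Ideal → Ideal → Set (c ⊔ ℓ)
  Adjacent I J = (¬ (I ≐ J)) × ProdEqInter I J

  IsMaximal : Ideal → Set (suc (c ⊔ ℓ))
  IsMaximal M = (¬ (1# ∈ M)) × (∀ N → M ⊆ N → (N ⊆ M) ⊎ (1# ∈ N))

  JacobsonZero : Set (suc (c ⊔ ℓ))
  JacobsonZero = ∀ x → (∀ M → IsMaximal M → x ∈ M) → x ≈ 0#

  DistLe2 : Ideal → Ideal → Set (suc (c ⊔ ℓ))
  DistLe2 I J =
    (I ≐ J) ⊎ (Adjacent I J ⊎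
      (Σ[ K ∈ Ideal ] (NonTrivial K × Adjacent I K × Adjacent K J)))

module Submission where

-- Let I ≠ J be non-trivial ideals of a ring R with J(R) = 0.
-- Classically, either some maximal ideal M contains neither I nor J, or
-- every maximal ideal contains I or J.
--   * In the first case M is comaximal with both I and J (I + M = R by
--     maximality), and comaximal ideals A, B always satisfy AB = A ∩ B;
--     moreover M is non-trivial, so I — M — J is a path of length 2.
--   * In the second case every element of I ∩ J lies in every maximal
--     ideal, hence in J(R) = 0; so I ∩ J = 0 ⊆ IJ and I, J are adjacent.

open import Defs
open import Level using (Level; _⊔_)
open import Algebra.Bundles using (CommutativeRing; CommutativeMonoid)
open import Axiom.ExcludedMiddle using (ExcludedMiddle)
open import Relation.Nullary using (¬_; yes; no)
open import Data.Product using (Σ-syntax; _×_; _,_; proj₁; proj₂)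
open import Data.Sum using (inj₁; inj₂)
open import Data.List using ([]; _∷_)
open import Data.List.Relation.Unary.All using (All; []; _∷_)
open import Data.Empty using (⊥-elim)
import Algebra.Properties.CommutativeSemigroup as CommSemigroupProperties
import Relation.Binary.Reasoning.Setoid as SetoidReasoning

module RingFacts {c ℓ : Level} (R : CommutativeRing c ℓ) where
  open CommutativeRing R
  open SetoidReasoning setoid
  open CommSemigroupProperties
    (CommutativeMonoid.commutativeSemigroup +-commutativeMonoid) using (interchange)

  product⊆intersection : (A B : Ideal R) →
    ∀ x → _∈Prod[_,_] R x A B → _∈Inter[_,_] R x A B
  product⊆intersection A B x (ps , factors , x≈sum) =
    sumIn ps factors x x≈sum
    where
    sumIn : ∀ ps → All (λ p → (_∈_ R (proj₁ p) A) × (_∈_ R (proj₂ p) B)) ps →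
            ∀ y → y ≈ sumProd R ps → _∈Inter[_,_] R y A B
    sumIn [] [] y y≈0 =
      mem-resp A (sym y≈0) (mem-0# A) , mem-resp B (sym y≈0) (mem-0# B)
    sumIn ((a , b) ∷ ps) ((a∈A , b∈B) ∷ factors) y y≈sum
      with sumIn ps factors (sumProd R ps) refl
    ... | rest∈A , rest∈B =
      mem-resp A (sym y≈sum) (mem-+ A (mem-resp A (*-comm b a) (mem-* A b a∈A)) rest∈A) ,
      mem-resp B (sym y≈sum) (mem-+ B (mem-* B a b∈B) rest∈B)

  zero∈product : (A B : Ideal R) → ∀ x → x ≈ 0# → _∈Prod[_,_] R x A B
  zero∈product A B x x≈0 = [] , [] , x≈0

  Comaximal : Ideal R → Ideal R → Set (c ⊔ ℓ)
  Comaximal A B = Σ[ a ∈ Carrier ] Σ[ b ∈ Carrier ]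
    (_∈_ R a A) × (_∈_ R b B) × (1# ≈ a + b)

  comaximal-sym : (A B : Ideal R) → Comaximal A B → Comaximal B A
  comaximal-sym A B (a , b , a∈A , b∈B , 1≈a+b) =
    b , a , b∈B , a∈A , trans 1≈a+b (+-comm a b)

  -- For comaximal ideals AB = A ∩ B: if x ∈ A ∩ B and 1 = a + b then
  -- x = a x + x b is a sum of two products from A × B.
  comaximal⇒product≡intersection : (A B : Ideal R) →
    Comaximal A B → ProdEqInter R A B
  comaximal⇒product≡intersection A B (a , b , a∈A , b∈B , 1≈a+b) x =
    product⊆intersection A B x , intersection⊆product
    where
    x≈ax+xb : x ≈ a * x + (x * b + 0#)
    x≈ax+xb = begin
      x                   ≈⟨ sym (*-identityʳ x) ⟩
      x * 1#              ≈⟨ *-congˡ 1≈a+b ⟩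
      x * (a + b)         ≈⟨ distribˡ x a b ⟩
      x * a + x * b       ≈⟨ +-cong (*-comm x a) (sym (+-identityʳ (x * b))) ⟩
      a * x + (x * b + 0#) ∎

    intersection⊆product : _∈Inter[_,_] R x A B → _∈Prod[_,_] R x A B
    intersection⊆product (x∈A , x∈B) =
      ((a , x) ∷ (x , b) ∷ []) , ((a∈A , x∈B) ∷ (x∈A , b∈B) ∷ []) , x≈ax+xb

  _⊕_ : Ideal R → Ideal R → Ideal R
  A ⊕ B = record
    { mem      = λ x → Σ[ a ∈ Carrier ] Σ[ b ∈ Carrier ]
                         (_∈_ R a A) × (_∈_ R b B) × (x ≈ a + b)
    ; mem-resp = λ { x≈y (a , b , a∈A , b∈B , x≈a+b) →
                     a , b , a∈A , b∈B , trans (sym x≈y) x≈a+b }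
    ; mem-0#   = 0# , 0# , mem-0# A , mem-0# B , sym (+-identityʳ 0#)
    ; mem-+    = λ { (a , b , a∈A , b∈B , x≈) (a' , b' , a'∈A , b'∈B , y≈) →
                     a + a' , b + b' , mem-+ A a∈A a'∈A , mem-+ B b∈B b'∈B ,
                     trans (+-cong x≈ y≈) (interchange a b a' b') }
    ; mem-*    = λ { r (a , b , a∈A , b∈B , x≈) →
                     r * a , r * b , mem-* A r a∈A , mem-* B r b∈B ,
                     trans (*-congˡ x≈) (distribˡ r a b) }
    }

  -- An ideal not contained in a maximal ideal M is comaximal with it,
  -- since A + M properly contains M.
  notContained⇒comaximal : (A M : Ideal R) → IsMaximal R M →
    ¬ (_⊆_ R A M) → Comaximal A M
  notContained⇒comaximal A M (_ , maximal) A⊈M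
    with maximal (A ⊕ M) (λ x x∈M → 0# , x , mem-0# A , x∈M , sym (+-identityˡ x))
  ... | inj₂ 1∈A+M = 1∈A+M
  ... | inj₁ A+M⊆M =
    ⊥-elim (A⊈M (λ x x∈A → A+M⊆M x (x , 0# , x∈A , mem-0# M , sym (+-identityʳ x))))

  -- A maximal ideal that fails to contain some proper ideal A is not the
  -- zero ideal (the zero ideal is contained in A), so it is non-trivial.
  maximal-nonTrivial : (A M : Ideal R) → ¬ (_∈_ R 1# A) → IsMaximal R M →
    ¬ (_⊆_ R A M) → NonTrivial R M
  maximal-nonTrivial A M A-proper (M-proper , maximal) A⊈M = M-nonzero , M-proper
    where
    M-nonzero : ¬ (∀ x → _∈_ R x M → x ≈ 0#)
    M-nonzero M-zero
      with maximal A (λ x x∈M → mem-resp A (sym (M-zero x x∈M)) (mem-0# A))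
    ... | inj₁ A⊆M = A⊈M A⊆M
    ... | inj₂ 1∈A = A-proper 1∈A

  jacobsonZero⇒product≡intersection : JacobsonZero R → (A B : Ideal R) →
    (∀ x → _∈Inter[_,_] R x A B → ∀ M → IsMaximal R M → _∈_ R x M) →
    ProdEqInter R A B
  jacobsonZero⇒product≡intersection jz A B ∩⊆maximals x =
    product⊆intersection A B x ,
    λ x∈A∩B → zero∈product A B x (jz x (∩⊆maximals x x∈A∩B))

open RingFacts

mainTheorem4 : (lem : ∀ {a} → ExcludedMiddle a)
    → {c ℓ : Level} (R : CommutativeRing c ℓ)
    → JacobsonZero R
    → (I J : Ideal R) → NonTrivial R I → NonTrivial R J → ¬ (_≐_ R I J)
    → DistLe2 R I J
mainTheorem4 lem R jz I J ntI ntJ I≠J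
  with lem {P = Σ[ M ∈ Ideal R ] IsMaximal R M × ¬ (_⊆_ R I M) × ¬ (_⊆_ R J M)}
... | yes (M , maxM , I⊈M , J⊈M) =
  inj₂ (inj₂ (M , maximal-nonTrivial R I M (proj₂ ntI) maxM I⊈M ,
    ((λ I≐M → I⊈M (proj₁ I≐M)) ,
     comaximal⇒product≡intersection R I M (notContained⇒comaximal R I M maxM I⊈M)) ,
    ((λ M≐J → J⊈M (proj₂ M≐J)) ,
     comaximal⇒product≡intersection R M J
       (comaximal-sym R J M (notContained⇒comaximal R J M maxM J⊈M)))))
... | no noSuchM =
  -- every maximal ideal contains I or J, so I ∩ J ⊆ J(R) = 0
  inj₂ (inj₁ (I≠J , jacobsonZero⇒product≡intersection R jz I J ∩⊆maximal))
  where
  ∩⊆maximal : ∀ x → _∈Inter[_,_] R x I J → ∀ M → IsMaximal R M → _∈_ R x M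
  ∩⊆maximal x (x∈I , x∈J) M maxM with lem {P = _⊆_ R I M} | lem {P = _⊆_ R J M}
  ... | yes I⊆M | _        = I⊆M x x∈I
  ... | no _    | yes J⊆M  = J⊆M x x∈J
  ... | no I⊈M  | no J⊈M   = ⊥-elim (noSuchM (M , maxM , I⊈M , J⊈M))
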